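{- Let $2\le n_1<n_2<\cdots<n_m$ be integers, $t_1,\dots,t_m$ positive integers, $\overline{t}_k=\sum_{i=1}^k t_i$ (with $\overline{t}_0=0$), $t=\overline{t}_m$, $N=\prod_{i=1}^m n_i^{t_i}$, and $G=K_{n_1}^{t_1}\square\cdots\square K_{n_m}^{t_m}$. Let $O=(v^1,\dots,v^N)$ be a list of $N$ elements of $V(G)$. Then $O$ is an ordering of $V(G)$ that induces a consecutive radio labeling of $G$ if and only if (i) for all $1<i\le N$ and all integers $1\le k<t$ with $i-k\ge 1$, the vertices $v^i$ and $v^{i-k}$ share at most $k-1$ coordinates, and (ii) $O$ contains no repetition, i.e. $v^i\neq v^j$ for $i\neq j$.
   Context: $K_n$ denotes the complete graph with vertex set $\{v_1,\dots,v_n\}$. The Cartesian product $H_1\square H_2$ has vertex set $V(H_1)\times V(H_2)$, with $(a,b)$ adjacent to $(a',b')$ iff ($a=a'$ and $b\sim b'$) or ($b=b'$ and $a\sim a'$); $H^s$ is the Cartesian product of $s$ copies of $H$. Vertices of $G$ are written as $t$-tuples $(x_1,\dots,x_t)$ where $x_j\in V(K_{n_k})$ whenever $\overline{t}_{k-1}<j\le\overline{t}_k$; the distance between two vertices is the number of coordinates in which they differ, and $G$ has diameter $t$. Two vertices share coordinate $j$ if their $j$-th entries are equal. A radio labeling of a connected graph $H$ is a map $f:V(H)\to\mathbb{Z}^+$ with $|f(u)-f(v)|\ge \mathrm{diam}(H)+1-d(u,v)$ for all distinct $u,v$. A consecutive radio labeling is a radio labeling that is a bijection onto $\{1,\dots,|V(H)|\}$.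 An ordering of $V(H)$ is a list $(v^1,\dots,v^{|V(H)|})$ of pairwise distinct vertices. The radio labeling induced by an ordering is defined by $f(v^1)=1$ and $f(v^i)=\min\{x\in\mathbb{Z}: x>f(v^{i-1}),\ |x-f(v^j)|\ge \mathrm{diam}(H)+1-d(v^i,v^j)\text{ for all }1\le j<i\}$. -}

module Defs where

open import Data.Nat using (ℕ; zero; suc; _+_; _*_; _∸_; _^_; _≤_; _<_; ∣_-_∣)
open import Data.Bool using (Bool; true; false)
open import Data.Fin using (Fin; toℕ) renaming (zero to fzero; suc to fsuc)
import Data.Fin as F
open import Data.Vec using (Vec; []; _∷_; lookup; replicate; _++_; sum; foldr)
open import Data.Product using (Σ; _×_; _,_)
open import Relation.Nullary using (¬_; does)
open import Relation.Binary.PropositionalEquality using (_≡_; _≢_)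

tot : {m : ℕ} → Vec ℕ m → ℕ
tot ts = sum ts

order : {m : ℕ} → Vec ℕ m → Vec ℕ m → ℕ
order [] [] = 1
order (n ∷ ns) (t ∷ ts) = n ^ t * order ns ts

-- Size of the j-th coordinate: coordinate j (0-based) lies in block k
-- (t̄_{k-1} ≤ j < t̄_k) and then ranges over V(K_{n_k}).
sizes : {m : ℕ} → (ns ts : Vec ℕ m) → Vec ℕ (tot ts)
sizes [] [] = []
sizes (n ∷ ns) (t ∷ ts) = replicate t n ++ sizes ns ts

-- Vertices of G = K_{n_1}^{t_1} □ ⋯ □ K_{n_m}^{t_m}: t-tuples, V(K_n) = Fin n.
-- (wrapped in a record so that ns, ts are inferable)
record Vertex {m : ℕ} (ns ts : Vec ℕ m) : Set where
  constructor vtx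
  field coord : (j : Fin (tot ts)) → Fin (lookup (sizes ns ts) j)
open Vertex public

_≈V_ : {m : ℕ} {ns ts : Vec ℕ m} → Vertex ns ts → Vertex ns ts → Set
x ≈V y = ∀ j → coord x j ≡ coord y j

count : (n : ℕ) → (Fin n → Bool) → ℕ
count zero p = 0
count (suc n) p with p fzero
... | true  = suc (count n (λ i → p (fsuc i)))
... | false = count n (λ i → p (fsuc i))

dist : {m : ℕ} {ns ts : Vec ℕ m} → Vertex ns ts → Vertex ns ts → ℕ
dist {ts = ts} x y = count (tot ts) (λ j → Data.Bool.not (does (coord x j F.≟ coord y j)))

shared : {m : ℕ} {ns ts : Vec ℕ m} → Vertex ns ts → Vertex ns ts → ℕ
shared {ts = ts} x y = count (tot ts) (λ j → does (coord x j F.≟ coord y j))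

-- A list O = (v^1,…,v^N) of N vertices, indexed by Fin N (position i ↦ v^{i+1}).
VList : {m : ℕ} → Vec ℕ m → Vec ℕ m → Set
VList ns ts = Fin (order ns ts) → Vertex ns ts

IsOrdering : {m : ℕ} {ns ts : Vec ℕ m} → VList ns ts → Set
IsOrdering O = ∀ i j → i ≢ j → ¬ (O i ≈V O j)

IsLeast : (ℕ → Set) → ℕ → Set
IsLeast P x = P x × (∀ y → P y → x ≤ y)

-- g : Fin N → ℕ, g i = f(v^{i+1}), is the radio labeling induced by O (diam G = t)
IsInduced : {m : ℕ} {ns ts : Vec ℕ m} → VList ns ts → (Fin (order ns ts) → ℕ) → Set
IsInduced {ts = ts} O g =
  (∀ i → toℕ i ≡ 0 → g i ≡ 1) ×
  (∀ i p → toℕ i ≡ suc (toℕ p) →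
     IsLeast (λ x → g p < x ×
                    (∀ j → toℕ j Data.Nat.< toℕ i →
                       suc (tot ts) ∸ dist (O i) (O j) ≤ ∣ x - g j ∣))
             (g i))

-- The labeling v^i ↦ g i of V(G) is a consecutive radio labeling of G
-- (given that O is an ordering, i.e. a bijection Fin N → V(G)).
IsConsecutiveRadio : {m : ℕ} {ns ts : Vec ℕ m} → VList ns ts → (Fin (order ns ts) → ℕ) → Set
IsConsecutiveRadio {ns = ns} {ts = ts} O g =
  (∀ i j → i ≢ j → suc (tot ts) ∸ dist (O i) (O j) ≤ ∣ g i - g j ∣) ×
  (∀ i → 1 ≤ g i × g i ≤ order ns ts) ×
  (∀ i j → g i ≡ g j → i ≡ j) ×
  (∀ x → 1 ≤ x → x ≤ order ns ts → Σ (Fin (order ns ts)) (λ i → g i ≡ x))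

CondI : {m : ℕ} {ns ts : Vec ℕ m} → VList ns ts → Set
CondI {ts = ts} O =
  ∀ (i j : Fin _) (k : ℕ) → 1 ≤ k → k < tot ts → toℕ j + k ≡ toℕ i →
    shared (O i) (O j) ≤ k ∸ 1

CondII : {m : ℕ} {ns ts : Vec ℕ m} → VList ns ts → Set
CondII O = ∀ i j → i ≢ j → ¬ (O i ≈V O j)

module Submission where

open import Defs
open import Data.Nat using (ℕ; zero; suc; _+_; _∸_; _≤_; _<_; ∣_-_∣; s≤s; z≤n)
open import Data.Nat.Properties
open import Data.Fin using (Fin; toℕ; fromℕ<) renaming (zero to fzero; suc to fsuc)
import Data.Fin as F
open import Data.Fin.Properties using (toℕ-injective; toℕ<n; toℕ-fromℕ<)
  renaming (<-cmp to <-cmpᶠ; <⇒≢ to <⇒≢ᶠ)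
open import Data.Vec using (Vec; lookup)
open import Data.Bool using (Bool; true; false; not)
open import Data.Product using (Σ; _×_; _,_; proj₁; proj₂)
open import Relation.Nullary using (¬_; yes; no; does; contradiction)
open import Relation.Binary.PropositionalEquality
open import Relation.Binary.Definitions using (tri<; tri≈; tri>)
open import Function using (_∘_)
open import Function.Bundles using (_⇔_; mk⇔; Equivalence)

-- In the labeling induced by an ordering every label exceeds the previous one, so a
-- consecutive one must be f(v^i) = i. For that labeling the radio condition between
-- v^i and v^(i-k) reads t + 1 - d ≤ k, i.e. (as shared + d = t) the two vertices share
-- at most k - 1 coordinates; for k ≥ t this fails only if they share all t
-- coordinates, i.e. coincide. Conversely, under (i) and (ii) the labeling i ↦ i is
-- radio, hence induced, each label being the least one above its predecessor.

count-+-count-not : ∀ n (p : Fin n → Bool) → count n p + count n (not ∘ p) ≡ n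
count-+-count-not zero    p = refl
count-+-count-not (suc n) p with p fzero | count-+-count-not n (p ∘ fsuc)
... | true  | ih = cong suc ih
... | false | ih = trans (+-suc (count n (p ∘ fsuc)) _) (cong suc ih)

count-cong : ∀ n {p q : Fin n → Bool} → (∀ j → p j ≡ q j) → count n p ≡ count n q
count-cong zero    p≗q = refl
count-cong (suc n) {p} {q} p≗q
  with p fzero | q fzero | p≗q fzero | count-cong n {p ∘ fsuc} {q ∘ fsuc} (p≗q ∘ fsuc)
... | true  | true  | _ | ih = cong suc ih
... | false | false | _ | ih = ih

count≡0⇒false : ∀ n (p : Fin n → Bool) → count n p ≡ 0 → ∀ j → p j ≡ false
count≡0⇒false (suc n) p c≡0 j with p fzero in p0
count≡0⇒false (suc n) p c≡0 fzero    | false = p0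
count≡0⇒false (suc n) p c≡0 (fsuc j) | false = count≡0⇒false n (p ∘ fsuc) c≡0 j

does-≟-sym : ∀ {k} (a b : Fin k) → does (a F.≟ b) ≡ does (b F.≟ a)
does-≟-sym a b with a F.≟ b | b F.≟ a
... | yes _   | yes _   = refl
... | no _    | no _    = refl
... | yes a≡b | no b≢a  = contradiction (sym a≡b) b≢a
... | no a≢b  | yes b≡a = contradiction (sym b≡a) a≢b

module _ {m : ℕ} {ns ts : Vec ℕ m} where

  shared+dist≡tot : (x y : Vertex ns ts) → shared x y + dist x y ≡ tot ts
  shared+dist≡tot x y = count-+-count-not (tot ts) (λ j → does (coord x j F.≟ coord y j))

  dist-sym : (x y : Vertex ns ts) → dist x y ≡ dist y x
  dist-sym x y = count-cong (tot ts) (λ j → cong not (does-≟-sym (coord x j) (coord y j)))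

  dist≡0⇒≈V : (x y : Vertex ns ts) → dist x y ≡ 0 → x ≈V y
  dist≡0⇒≈V x y d≡0 j with coord x j F.≟ coord y j | count≡0⇒false (tot ts) _ d≡0 j
  ... | yes xj≡yj | _ = xj≡yj

  suc-tot∸dist≡suc-shared : (x y : Vertex ns ts) → suc (tot ts) ∸ dist x y ≡ suc (shared x y)
  suc-tot∸dist≡suc-shared x y = begin
    suc (tot ts) ∸ dist x y                ≡⟨ cong (λ n → suc n ∸ dist x y) (shared+dist≡tot x y) ⟨
    suc (shared x y) + dist x y ∸ dist x y ≡⟨ m+n∸n≡m (suc (shared x y)) (dist x y) ⟩
    suc (shared x y)                       ∎
    where open ≡-Reasoning

  ≉V⇒shared<tot : (x y : Vertex ns ts) → ¬ (x ≈V y) → shared x y < tot ts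
  ≉V⇒shared<tot x y x≉y = subst (shared x y <_) (shared+dist≡tot x y)
    (m<m+n (shared x y) (n≢0⇒n>0 (x≉y ∘ dist≡0⇒≈V x y)))

module _ {N : ℕ} (f : Fin N → ℕ)
         (increasing : ∀ i p → toℕ i ≡ suc (toℕ p) → f p < f i) where

  increasing-+ : ∀ r {p i} → toℕ p + r ≡ toℕ i → f p + r ≤ f i
  increasing-+ zero {p} {i} p+0≡i =
    ≤-reflexive (trans (+-identityʳ (f p)) (cong f (toℕ-injective (trans (sym (+-identityʳ (toℕ p))) p+0≡i))))
  increasing-+ (suc r) {p} {i} p+1+r≡i = begin
    f p + suc r     ≡⟨ +-suc (f p) r ⟩
    suc (f p + r)   ≤⟨ s≤s (increasing-+ r (sym (toℕ-fromℕ< q<N))) ⟩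
    suc (f q)       ≤⟨ increasing i q i≡1+q ⟩
    f i             ∎
    where
    open ≤-Reasoning
    q<N : toℕ p + r < N
    q<N = <-trans (subst (toℕ p + r <_) p+1+r≡i (+-monoʳ-< (toℕ p) (n<1+n r))) (toℕ<n i)
    q : Fin N
    q = fromℕ< q<N
    i≡1+q : toℕ i ≡ suc (toℕ q)
    i≡1+q = trans (sym p+1+r≡i) (trans (+-suc (toℕ p) r) (cong suc (sym (toℕ-fromℕ< q<N))))

  -- only the extreme positions matter: f 0 ≥ 1 forces f i ≥ i + 1, and f (N - 1) ≤ N forces f i ≤ i + 1
  increasing-in-range⇒≡suc-toℕ : (∀ i → 1 ≤ f i × f i ≤ N) → ∀ i → f i ≡ suc (toℕ i)
  increasing-in-range⇒≡suc-toℕ range i = ≤-antisym upper lower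
    where
    first : Fin N
    first = fromℕ< (≤-<-trans z≤n (toℕ<n i))
    lower : suc (toℕ i) ≤ f i
    lower = ≤-trans (+-monoˡ-≤ (toℕ i) (proj₁ (range first)))
                    (increasing-+ (toℕ i) (cong (_+ toℕ i) (toℕ-fromℕ< _)))
    r : ℕ
    r = N ∸ suc (toℕ i)
    i+1+r≡N : suc (toℕ i) + r ≡ N
    i+1+r≡N = m+[n∸m]≡n (toℕ<n i)
    last : Fin N
    last = fromℕ< (≤-reflexive i+1+r≡N)
    upper : f i ≤ suc (toℕ i)
    upper = +-cancelʳ-≤ r (f i) (suc (toℕ i)) (begin
      f i + r          ≤⟨ increasing-+ r (sym (toℕ-fromℕ< _)) ⟩
      f last           ≤⟨ proj₂ (range last) ⟩
      N                ≡⟨ i+1+r≡N ⟨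
      suc (toℕ i) + r  ∎)
      where open ≤-Reasoning

<⇒≤∸1 : ∀ {s k} → s < k → s ≤ k ∸ 1
<⇒≤∸1 (s≤s s≤k-1) = s≤k-1

≤∸1⇒< : ∀ {s k} → 1 ≤ k → s ≤ k ∸ 1 → s < k
≤∸1⇒< {k = suc _} _ s≤k-1 = s≤s s≤k-1

module _ {m : ℕ} {ns ts : Vec ℕ m} (O : VList ns ts) where

  SharedBelowGap : Set
  SharedBelowGap = ∀ i j → j F.< i → shared (O i) (O j) < toℕ i ∸ toℕ j

  radio⇔shared<gap : ∀ {i j} → j F.< i →
    (suc (tot ts) ∸ dist (O i) (O j) ≤ ∣ toℕ i - toℕ j ∣) ⇔ (shared (O i) (O j) < toℕ i ∸ toℕ j)
  radio⇔shared<gap {i} {j} j<i = mk⇔ (subst₂ _≤_ bound≡ gap≡) (subst₂ _≤_ (sym bound≡) (sym gap≡))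
    where
    bound≡ : suc (tot ts) ∸ dist (O i) (O j) ≡ suc (shared (O i) (O j))
    bound≡ = suc-tot∸dist≡suc-shared (O i) (O j)
    gap≡ : ∣ toℕ i - toℕ j ∣ ≡ toℕ i ∸ toℕ j
    gap≡ = m≤n⇒∣n-m∣≡n∸m (<⇒≤ j<i)

  condI×condII⇒sharedBelowGap : CondI O → CondII O → SharedBelowGap
  condI×condII⇒sharedBelowGap condI condII i j j<i with toℕ i ∸ toℕ j <? tot ts
  ... | yes gap<t = ≤∸1⇒< 1≤gap (condI i j (toℕ i ∸ toℕ j) 1≤gap gap<t (m+[n∸m]≡n (<⇒≤ j<i)))
    where
    1≤gap : 1 ≤ toℕ i ∸ toℕ j
    1≤gap = m<n⇒0<n∸m j<i
  ... | no gap≮t =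
    <-≤-trans (≉V⇒shared<tot (O i) (O j) (condII i j (≢-sym (<⇒≢ᶠ j<i)))) (≮⇒≥ gap≮t)

  sharedBelowGap⇒condI : SharedBelowGap → CondI O
  sharedBelowGap⇒condI below i j k 1≤k _ j+k≡i =
    <⇒≤∸1 (subst (shared (O i) (O j) <_) gap≡k (below i j j<i))
    where
    j<i : j F.< i
    j<i = subst (toℕ j <_) j+k≡i (m<m+n (toℕ j) 1≤k)
    gap≡k : toℕ i ∸ toℕ j ≡ k
    gap≡k = trans (cong (_∸ toℕ j) (sym j+k≡i)) (m+n∸m≡n (toℕ j) k)

  induced×consecutiveRadio⇒sharedBelowGap : ∀ {g} → IsInduced O g → IsConsecutiveRadio O g → SharedBelowGap
  induced×consecutiveRadio⇒sharedBelowGap {g} (_ , induced) (radio , range , _) i j j<i =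
    Equivalence.to (radio⇔shared<gap j<i)
      (subst₂ (λ a b → suc (tot ts) ∸ dist (O i) (O j) ≤ ∣ a - b ∣) (g≡ i) (g≡ j)
        (radio i j (≢-sym (<⇒≢ᶠ j<i))))
    where
    g≡ : ∀ i → g i ≡ suc (toℕ i)
    g≡ = increasing-in-range⇒≡suc-toℕ g (λ i p i≡1+p → proj₁ (proj₁ (induced i p i≡1+p))) range

  sharedBelowGap⇒radio : SharedBelowGap →
    ∀ i j → i ≢ j → suc (tot ts) ∸ dist (O i) (O j) ≤ ∣ toℕ i - toℕ j ∣
  sharedBelowGap⇒radio below i j i≢j with <-cmpᶠ i j
  ... | tri< i<j _ _ =
    subst₂ (λ d gap → suc (tot ts) ∸ d ≤ gap) (dist-sym (O j) (O i)) (∣-∣-comm (toℕ j) (toℕ i))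
      (Equivalence.from (radio⇔shared<gap i<j) (below j i i<j))
  ... | tri≈ _ i≡j _ = contradiction i≡j i≢j
  ... | tri> _ _ j<i = Equivalence.from (radio⇔shared<gap j<i) (below i j j<i)

  sharedBelowGap⇒induced : SharedBelowGap → IsInduced O (suc ∘ toℕ)
  sharedBelowGap⇒induced below = (λ i → cong suc) , λ i p i≡1+p →
    (≤-reflexive (cong suc (sym i≡1+p)) , λ j j<i → Equivalence.from (radio⇔shared<gap j<i) (below i j j<i)) ,
    λ y (p+1<y , _) → subst (_≤ y) (cong suc (sym i≡1+p)) p+1<y

  sharedBelowGap⇒consecutiveRadio : SharedBelowGap → IsConsecutiveRadio O (suc ∘ toℕ)
  sharedBelowGap⇒consecutiveRadio below =
    sharedBelowGap⇒radio below , (λ i → s≤s z≤n , toℕ<n i) ,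
    (λ i j → toℕ-injective ∘ suc-injective) , surjective
    where
    surjective : ∀ x → 1 ≤ x → x ≤ order ns ts → Σ (Fin (order ns ts)) (λ i → suc (toℕ i) ≡ x)
    surjective (suc x) _ x<N = fromℕ< x<N , cong suc (toℕ-fromℕ< x<N)

proposition7 : (m : ℕ) (ns ts : Vec ℕ m) →
    (∀ i → 2 ≤ lookup ns i) →
    (∀ (i j : Fin m) → Data.Fin._<_ i j → lookup ns i < lookup ns j) →
    (∀ i → 1 ≤ lookup ts i) →
    (O : VList ns ts) →
    (IsOrdering O × Σ (Fin (order ns ts) → ℕ) (λ g → IsInduced O g × IsConsecutiveRadio O g))
    ⇔ (CondI O × CondII O)
proposition7 m ns ts _ _ _ O = mk⇔
  (λ (ordering , g , induced , consecutive) →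
     sharedBelowGap⇒condI O (induced×consecutiveRadio⇒sharedBelowGap O induced consecutive) , ordering)
  (λ (condI , condII) →
     let below = condI×condII⇒sharedBelowGap O condI condII
     in condII , suc ∘ toℕ , sharedBelowGap⇒induced O below , sharedBelowGap⇒consecutiveRadio O below)
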